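{- For every integer $q \geq 2$ and every $q$-palette $C$ over a field $\mathbb{F}$, there exists a polynomial $f : \mathbb{F}^{q \times q} \to \mathbb{F}$ of degree $q-1$ in the $q^2$ variables corresponding to the entries of a $q \times q$ matrix, such that for every $C$-colored matrix $M = (a_1, \ldots, a_q) \in \mathbb{F}^{q \times q}$ we have $f(M) = 0$ if and only if there exist distinct $i, j \in \{1,\ldots,q\}$ with $a_i = a_j$.
   Context: For an integer $q \geq 2$ and a field $\mathbb{F}$, a $q$-palette over $\mathbb{F}$ is a set $C = \{c_1, \ldots, c_q\}$ of $q$ vectors in $\mathbb{F}^q$ such that: (1) the first entry of each $c_i$ is $1$; (2) $C$ is linearly independent over $\mathbb{F}$; and (3) for every $S \subseteq \{1,\ldots,q\}$ with $|S| = q-1$, the vectors in $\mathbb{F}^{q-1}$ obtained from $c_i$, $i \in S$, by omitting their last entry are linearly independent over $\mathbb{F}$. A matrix $M = (a_1, \ldots, a_m) \in \mathbb{F}^{q \times m}$ (with columns $a_1,\ldots,a_m$) is $C$-colored if $a_i \in C$ for all $i$. -}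

module Defs where

open import Level using (Level; _⊔_; suc)
open import Algebra.Bundles using (CommutativeRing)
open import Data.Nat as ℕ using (ℕ; zero; _≤_)
  renaming (suc to sucℕ)
open import Data.Fin using (Fin; inject₁; punchIn)
open import Data.List using (List)
open import Data.List.Relation.Unary.All using (All)
open import Data.List.Relation.Unary.Any using (Any)
open import Data.List.Relation.Unary.AllPairs using (AllPairs)
open import Data.Product using (Σ; _×_; _,_; proj₁; proj₂; ∃)
open import Relation.Nullary using (¬_)
open import Relation.Binary.PropositionalEquality using (_≡_)

record Field (c ℓ : Level) : Set (Level.suc (c ⊔ ℓ)) where
  field
    commutativeRing : CommutativeRing c ℓ
  open CommutativeRing commutativeRing public
  field
    0#≉1#   : ¬ (0# ≈ 1#)
    inverse : ∀ x → ¬ (x ≈ 0#) → Σ Carrier λ y → (x * y) ≈ 1#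

sumℕ : ∀ n → (Fin n → ℕ) → ℕ
sumℕ zero f = 0
sumℕ (sucℕ n) f = f Fin.zero ℕ.+ sumℕ n (λ i → f (Fin.suc i))

module _ {c ℓ : Level} (F : Field c ℓ) where
  open Field F

  Σ[_] : ∀ n → (Fin n → Carrier) → Carrier
  Σ[ zero ] f = 0#
  Σ[ sucℕ n ] f = f Fin.zero + Σ[ n ] (λ i → f (Fin.suc i))

  Π[_] : ∀ n → (Fin n → Carrier) → Carrier
  Π[ zero ] f = 1#
  Π[ sucℕ n ] f = f Fin.zero * Π[ n ] (λ i → f (Fin.suc i))

  _^_ : Carrier → ℕ → Carrier
  x ^ zero = 1#
  x ^ sucℕ k = x * (x ^ k)

  Vector : ℕ → Set c
  Vector n = Fin n → Carrier

  LinearlyIndependent : ∀ {m n} → (Fin m → Vector n) → Set (c ⊔ ℓ)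
  LinearlyIndependent {m} {n} v =
    (λs : Fin m → Carrier) →
    (∀ (r : Fin n) → Σ[ m ] (λ i → λs i * v i r) ≈ 0#) →
    ∀ (i : Fin m) → λs i ≈ 0#

  dropLast : ∀ {p} → Vector (sucℕ p) → Vector p
  dropLast v r = v (inject₁ r)

  -- A q-palette with q = p + 1, given as an indexed family c₁,…,c_q
  -- (independence forces the c_i to be pairwise distinct, so this is a set
  -- of exactly q vectors).  The subsets S of size q-1 are exactly the
  -- complements of a single index k; `punchIn k` enumerates them.
  record IsPalette {p : ℕ} (col : Fin (sucℕ p) → Vector (sucℕ p)) : Set (c ⊔ ℓ) where
    field
      firstEntry  : ∀ i → col i Fin.zero ≈ 1#
      independent : LinearlyIndependent col
      dropIndep   : ∀ (k : Fin (sucℕ p)) →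
                    LinearlyIndependent (λ (j : Fin p) → dropLast (col (punchIn k j)))

  -- Matrices 𝔽^{q×q}, as functions row ↦ column ↦ entry.
  Matrix : ℕ → Set c
  Matrix q = Fin q → Fin q → Carrier

  column : ∀ {q} → Matrix q → Fin q → Vector q
  column M j r = M r j

  Colored : ∀ {q} → (Fin q → Vector q) → Matrix q → Set ℓ
  Colored {q} col M = ∀ (j : Fin q) → ∃ λ (i : Fin q) → ∀ (r : Fin q) → M r j ≈ col i r

  Exponent : ℕ → Set
  Exponent q = Fin q → Fin q → ℕ

  totalDeg : ∀ {q} → Exponent q → ℕ
  totalDeg {q} e = sumℕ q (λ r → sumℕ q (λ s → e r s))

  Term : ℕ → Set c
  Term q = Carrier × Exponent q

  record Polynomial (q : ℕ) : Set (c ⊔ ℓ) where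
    field
      terms    : List (Term q)
      nonzero  : All (λ t → ¬ (proj₁ t ≈ 0#)) terms
      distinct : AllPairs (λ t u → ¬ (∀ r s → proj₂ t r s ≡ proj₂ u r s)) terms
  open Polynomial public

  evalMonomial : ∀ {q} → Exponent q → Matrix q → Carrier
  evalMonomial {q} e M = Π[ q ] (λ r → Π[ q ] (λ s → M r s ^ e r s))

  evalTerms : ∀ {q} → List (Term q) → Matrix q → Carrier
  evalTerms List.[] M = 0#
  evalTerms ((a , e) List.∷ ts) M = (a * evalMonomial e M) + evalTerms ts M

  eval : ∀ {q} → Polynomial q → Matrix q → Carrier
  eval f M = evalTerms (terms f) M

  HasDegree : ∀ {q} → Polynomial q → ℕ → Set c
  HasDegree f d = All (λ t → totalDeg (proj₂ t) ≤ d) (terms f)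
                × Any (λ t → totalDeg (proj₂ t) ≡ d) (terms f)

{-# OPTIONS --safe #-}
-- Take f(M) = Σₜ (-1)ᵗ det Mₜ, where Mₜ deletes the first row and the t-th column of M: the
-- Laplace expansion of det M along its first row with every entry of that row replaced by 1.
-- Its terms ±(a monomial of some det Mₜ) have degree q-1 and pairwise distinct exponents, as
-- an exponent records which entries of M it uses.  Palette vectors start with 1, so f(M) = det M
-- on C-coloured matrices.  A repeated column makes det M vanish.  Otherwise the colouring is
-- injective, the columns of M are the palette vectors in some order, hence linearly
-- independent, and Gaussian elimination shows that det M ≠ 0.
module Submission where

open import Level using (Level; _⊔_)
open import Defs
open import Algebra.Bundles using (CommutativeMonoid; CommutativeRing)
open import Data.Vec.Functional using (head; tail; removeAt; updateAt; zipWith)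
open import Data.Nat as ℕ using (ℕ; zero; suc; _≤_; _∸_)
import Data.Nat.Properties as ℕ
open import Data.Fin using (Fin; zero; suc; punchIn; punchOut; _<_; _≟_)
open import Data.Fin.Properties
  using (any?; suc-injective; punchInᵢ≢i; punchIn-injective; punchIn-punchOut; <-cmp; <⇒≢; <-trans)
open import Data.Vec.Functional.Properties using (updateAt-updates; updateAt-minimal; updateAt-id-local; updateAt-commutes)
open import Data.Product as Product using (Σ; _×_; _,_; proj₁; proj₂; ∃; ∃₂)
open import Data.Sum as Sum using (_⊎_; inj₁; inj₂; [_,_]′)
open import Function using (_∘_; const; flip; id)
open import Function.Definitions using (Injective)
open import Function.Bundles using (_⇔_; mk⇔)
open import Data.List as List using (List; []; _∷_; _++_; allFin; concat; tabulate)
open import Data.List.Membership.Propositional using (_∈_)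
open import Data.List.Membership.Propositional.Properties using (∈-allFin)
open import Data.List.Relation.Unary.Any using (Any; here; there)
import Data.List.Relation.Unary.Any.Properties as Any
open import Data.List.Relation.Unary.All as All using (All; []; _∷_)
import Data.List.Relation.Unary.All.Properties as All
open import Data.List.Relation.Unary.AllPairs as AllPairs using (AllPairs; []; _∷_)
import Data.List.Relation.Unary.AllPairs.Properties as AllPairs
open import Data.Unit using (⊤; tt)
open import Relation.Binary.Construct.Closure.Transitive using (TransClosure; [_]; _∷_)
open import Relation.Binary.Construct.Closure.ReflexiveTransitive using (Star; ε; _◅_)
open import Relation.Binary.Core using (Rel)
open import Relation.Binary.Definitions using (tri<; tri≈; tri>)
open import Relation.Binary.PropositionalEquality as ≡ using (_≡_; _≢_; _≗_)
open import Relation.Nullary using (¬_; yes; no)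
open import Relation.Nullary.Negation using (contradiction)
open import Relation.Nullary.Decidable using (¬¬-excluded-middle; decidable-stable; ¬?; _×-dec_)

data Adjacent : ∀ {n} → Fin n → Fin n → Set where
  zero : ∀ {n} → Adjacent {suc (suc n)} zero (suc zero)
  suc  : ∀ {n} {x y : Fin n} → Adjacent x y → Adjacent (suc x) (suc y)

adjacent⇒< : ∀ {n} {x y : Fin n} → Adjacent x y → x < y
adjacent⇒< zero    = ℕ.z<s
adjacent⇒< (suc a) = ℕ.s<s (adjacent⇒< a)

adjacent⇒≢ : ∀ {n} {x y : Fin n} → Adjacent x y → x ≢ y
adjacent⇒≢ = <⇒≢ ∘ adjacent⇒<

punchIn-adjacent : ∀ {n} {x y : Fin (suc n)} → Adjacent x y → ∀ j →
                   punchIn x j ≡ punchIn y j ⊎ (punchIn x j ≡ y × punchIn y j ≡ x)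
punchIn-adjacent zero    zero    = inj₂ (≡.refl , ≡.refl)
punchIn-adjacent zero    (suc j) = inj₁ ≡.refl
punchIn-adjacent (suc a) zero    = inj₁ ≡.refl
punchIn-adjacent (suc a) (suc j) with punchIn-adjacent a j
... | inj₁ eq         = inj₁ (≡.cong suc eq)
... | inj₂ (eq , eq′) = inj₂ (≡.cong suc eq , ≡.cong suc eq′)

adjacent-punchOut : ∀ {n} {x y t : Fin (suc n)} → Adjacent x y → t ≢ x → t ≢ y →
                    ∃₂ λ x′ y′ → Adjacent x′ y′ × punchIn t x′ ≡ x × punchIn t y′ ≡ y
adjacent-punchOut {t = zero}      zero    t≢x _   = contradiction ≡.refl t≢x
adjacent-punchOut {t = suc zero}  zero    _   t≢y = contradiction ≡.refl t≢y
adjacent-punchOut {n = suc (suc n)} {t = suc (suc t)} zero _ _ = zero , suc zero , zero , ≡.refl , ≡.refl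
adjacent-punchOut {t = zero}      (suc a) _   _   = _ , _ , a , ≡.refl , ≡.refl
adjacent-punchOut {n = suc n} {t = suc t} (suc a) t≢x t≢y
  with x′ , y′ , a′ , eq , eq′ ← adjacent-punchOut a (t≢x ∘ ≡.cong suc) (t≢y ∘ ≡.cong suc)
  = suc x′ , suc y′ , suc a′ , ≡.cong suc eq , ≡.cong suc eq′

suc⁺ : ∀ {n} {x y : Fin n} → TransClosure Adjacent x y → TransClosure Adjacent (suc x) (suc y)
suc⁺ [ a ]    = [ suc a ]
suc⁺ (a ∷ as) = suc a ∷ suc⁺ as

<⇒adjacent⁺ : ∀ {n} {x y : Fin n} → x < y → TransClosure Adjacent x y
<⇒adjacent⁺ {x = zero}  {suc zero}    _ = [ zero ]
<⇒adjacent⁺ {x = zero}  {suc (suc y)} _ = zero ∷ suc⁺ (<⇒adjacent⁺ {x = zero} {suc y} ℕ.z<s)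
<⇒adjacent⁺ {x = suc x} {suc y}       (ℕ.s<s x<y) = suc⁺ (<⇒adjacent⁺ x<y)

adjacent⁺⇒< : ∀ {n} {x y : Fin n} → TransClosure Adjacent x y → x < y
adjacent⁺⇒< [ x~y ]      = adjacent⇒< x~y
adjacent⁺⇒< (x~p ∷ p~⁺y) = <-trans (adjacent⇒< x~p) (adjacent⁺⇒< p~⁺y)

≢punchOut⇒punchIn≢ : ∀ {n} {x y : Fin (suc n)} (x≢y : x ≢ y) {j} → j ≢ punchOut x≢y → punchIn x j ≢ y
≢punchOut⇒punchIn≢ {x = x} x≢y j≢y′ = j≢y′ ∘ punchIn-injective x _ _ ∘ flip ≡.trans (≡.sym (punchIn-punchOut x≢y))

_[_]≔_ : ∀ {a} {A : Set a} {n} → (Fin n → A) → Fin n → A → Fin n → A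
v [ k ]≔ a = updateAt v k (const a)

finite-excluded-middle : ∀ {p} n (P : Fin n → Set p) → ¬ ¬ ((∀ i → P i) ⊎ ∃ λ i → ¬ P i)
finite-excluded-middle zero    P k = k (inj₁ λ ())
finite-excluded-middle (suc n) P k = finite-excluded-middle n (P ∘ suc) λ
  { (inj₂ (i , ¬Pi)) → k (inj₂ (suc i , ¬Pi))
  ; (inj₁ Psuc)      → ¬¬-excluded-middle λ
      { (yes P0) → k (inj₁ λ { zero → P0 ; (suc i) → Psuc i })
      ; (no ¬P0) → k (inj₂ (zero , ¬P0)) } }

injective-or-collision : ∀ {m n} (φ : Fin m → Fin n) →
                         Injective _≡_ _≡_ φ ⊎ ∃₂ λ i j → i ≢ j × φ i ≡ φ j
injective-or-collision φ with any? (λ i → any? (λ j → ¬? (i ≟ j) ×-dec (φ i ≟ φ j)))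
... | yes (i , j , i≢j , φᵢ≡φⱼ) = inj₂ (i , j , i≢j , φᵢ≡φⱼ)
... | no no-collision          = inj₁ λ {i} {j} φᵢ≡φⱼ →
  decidable-stable (i ≟ j) λ i≢j → no-collision (i , j , i≢j , φᵢ≡φⱼ)

nonempty-All⇒Any : ∀ {a p} {A : Set a} {P : A → Set p} {xs} → Any (λ _ → ⊤) xs → All P xs → Any P xs
nonempty-All⇒Any _ (px ∷ _) = here px

AllPairs-blocks : ∀ {a r i} {A : Set a} {R : A → A → Set r} {n} {B : Fin n → List A}
                  (Tag : Fin n → A → Set i) → (∀ t → AllPairs R (B t)) → (∀ t → All (Tag t) (B t)) →
                  (∀ {t t′} → t ≢ t′ → ∀ {x y} → Tag t x → Tag t′ y → R x y) →
                  AllPairs R (concat (tabulate B))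
AllPairs-blocks Tag within tagged separated = AllPairs.concat⁺ (All.tabulate⁺ within)
  (AllPairs.tabulate⁺ λ t≢t′ → All.map (λ tagₓ → All.map (separated t≢t′ tagₓ) (tagged _)) (tagged _))

module CommutativeMonoidSum {a ℓ} (M : CommutativeMonoid a ℓ) where

  open CommutativeMonoid M
    renaming (_∙_ to _+_; ε to 0#; ∙-cong to +-cong; ∙-congˡ to +-congˡ; identityʳ to +-identityʳ; assoc to +-assoc)
  open import Algebra.Properties.CommutativeMonoid.Sum M public using (sum)
  open import Algebra.Properties.CommutativeMonoid.Sum M using (sum-remove; sum-cong-≋; sum-replicate-zero)
  open import Relation.Binary.Reasoning.Setoid setoid

  sum-zero : ∀ {n} {f : Fin n → Carrier} → (∀ i → f i ≈ 0#) → sum f ≈ 0#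
  sum-zero {n} f≈0 = trans (sum-cong-≋ f≈0) (sum-replicate-zero n)

  sum-single : ∀ {n} {f : Fin n → Carrier} k → (∀ i → i ≢ k → f i ≈ 0#) → sum f ≈ f k
  sum-single {suc n} {f} k f≈0 = begin
    sum f                    ≈⟨ sum-remove f ⟩
    f k + sum (removeAt f k) ≈⟨ +-congˡ (sum-zero (λ j → f≈0 _ (punchInᵢ≢i k j))) ⟩
    f k + 0#                 ≈⟨ +-identityʳ (f k) ⟩
    f k                      ∎

  sum-pair : ∀ {n} {f : Fin n → Carrier} {x y} → x ≢ y →
             (∀ i → i ≢ x → i ≢ y → f i ≈ 0#) → sum f ≈ f x + f y
  sum-pair {suc n} {f} {x} {y} x≢y f≈0 = begin
    sum f                    ≈⟨ sum-remove f ⟩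
    f x + sum (removeAt f x) ≈⟨ +-congˡ (sum-single y′ λ j → f≈0 _ (punchInᵢ≢i x j) ∘ ≢punchOut⇒punchIn≢ x≢y) ⟩
    f x + f (punchIn x y′)   ≡⟨ ≡.cong (λ i → f x + f i) (punchIn-punchOut x≢y) ⟩
    f x + f y                ∎
    where y′ = punchOut x≢y

  sum-update : ∀ {n} {f g : Fin n → Carrier} k x → (∀ i → i ≢ k → g i ≈ f i) → g k ≈ x + f k →
               sum g ≈ x + sum f
  sum-update {suc n} {f} {g} k x g≈f gₖ = begin
    sum g                            ≈⟨ sum-remove g ⟩
    g k + sum (removeAt g k)         ≈⟨ +-cong gₖ (sum-cong-≋ λ j → g≈f _ (punchInᵢ≢i k j)) ⟩
    (x + f k) + sum (removeAt f k)   ≈⟨ +-assoc x (f k) _ ⟩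
    x + (f k + sum (removeAt f k))   ≈⟨ +-congˡ (sum-remove f) ⟨
    x + sum f                        ∎

-- A square matrix is the family v of its columns: v j r is the entry in row r, column j.
module Determinant {c ℓ : Level} (R : CommutativeRing c ℓ) where

  open CommutativeRing R hiding (zero)
  open import Algebra.Properties.Ring ring using (-0#≈0#; -‿involutive; -‿distribˡ-*; -‿distribʳ-*; +-inverseʳ-unique)
  open CommutativeMonoidSum +-commutativeMonoid using (sum-zero; sum-single; sum-pair)
  open import Algebra.Properties.Semiring.Sum semiring using (sum; sum-cong-≋; ∑-distrib-+; *-distribˡ-sum)
  open import Data.Vec.Functional.Relation.Binary.Equality.Setoid setoid using (_≋_; ≋-sym; ≋-trans; ≋-reflexive)
  open import Relation.Binary.Reasoning.Setoid setoid

  sign : ∀ {n} → Fin n → Carrier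
  sign zero    = 1#
  sign (suc i) = - sign i

  minor : ∀ {m n} → Fin (suc m) → (Fin (suc m) → Fin (suc n) → Carrier) → Fin m → Fin n → Carrier
  minor t v = tail ∘ removeAt v t

  det : ∀ {m} → (Fin m → Fin m → Carrier) → Carrier
  cofactor : ∀ {m} → Fin (suc m) → (Fin (suc m) → Fin (suc m) → Carrier) → Carrier

  det {zero}  v = 1#
  det {suc m} v = sum λ t → head (v t) * cofactor t v

  cofactor t v = sign t * det (minor t v)

  det-cong : ∀ {m} {v w : Fin m → Fin m → Carrier} → (∀ j → v j ≋ w j) → det v ≈ det w
  det-cong {zero}  v≋w = refl
  det-cong {suc m} v≋w = sum-cong-≋ λ t →
    *-cong (v≋w t zero) (*-congˡ {sign t} (det-cong λ j i → v≋w (punchIn t j) (suc i)))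

  minor-agrees : ∀ {m n} {u v : Fin (suc m) → Fin (suc n) → Carrier} {t k} (t≢k : t ≢ k) →
                 (∀ j → j ≢ k → u j ≋ v j) → ∀ j → j ≢ punchOut t≢k → minor t u j ≋ minor t v j
  minor-agrees t≢k u≋v j j≢k′ = u≋v _ (≢punchOut⇒punchIn≢ t≢k j≢k′) ∘ suc

  det-linear : ∀ {m} {u v w : Fin m → Fin m → Carrier} k α →
               (∀ j → j ≢ k → u j ≋ v j) → (∀ j → j ≢ k → w j ≋ v j) →
               (∀ r → u k r ≈ v k r + α * w k r) → det u ≈ det v + α * det w
  det-linear {suc m} {u} {v} {w} k α u≋v w≋v uₖ = begin
    sum (λ t → head (u t) * cofactor t u)
      ≈⟨ sum-cong-≋ expand ⟩
    sum (λ t → head (v t) * cofactor t v + α * (head (w t) * cofactor t w))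
      ≈⟨ ∑-distrib-+ (λ t → head (v t) * cofactor t v) (λ t → α * (head (w t) * cofactor t w)) ⟩
    det v + sum (λ t → α * (head (w t) * cofactor t w))
      ≈⟨ +-congˡ (sym (*-distribˡ-sum α (λ t → head (w t) * cofactor t w))) ⟩
    det v + α * det w ∎
    where
    open import Algebra.Solver.Ring.NaturalCoefficients.Default commutativeSemiring
    expand : ∀ t → head (u t) * cofactor t u ≈ head (v t) * cofactor t v + α * (head (w t) * cofactor t w)
    expand t with t ≟ k
    ... | yes ≡.refl = begin
      head (u t) * cofactor t u
        ≈⟨ *-cong (uₖ zero) (*-congˡ (det-cong λ j → u≋v _ (punchInᵢ≢i t j) ∘ suc)) ⟩
      (head (v t) + α * head (w t)) * cofactor t v
        ≈⟨ solve 4 (λ a α b C → (a :+ α :* b) :* C := a :* C :+ α :* (b :* C)) refl _ α _ _ ⟩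
      head (v t) * cofactor t v + α * (head (w t) * cofactor t v)
        ≈⟨ +-congˡ (*-congˡ (*-congˡ (*-congˡ (det-cong λ j → ≋-sym (w≋v _ (punchInᵢ≢i t j)) ∘ suc)))) ⟩
      head (v t) * cofactor t v + α * (head (w t) * cofactor t w) ∎
    ... | no t≢k = begin
      head (u t) * (sign t * det (minor t u))
        ≈⟨ *-cong (u≋v t t≢k zero) (*-congˡ minor-linear) ⟩
      head (v t) * (sign t * (det (minor t v) + α * det (minor t w)))
        ≈⟨ solve 5 (λ a s α D E → a :* (s :* (D :+ α :* E)) := a :* (s :* D) :+ α :* (a :* (s :* E))) refl _ _ α _ _ ⟩
      head (v t) * cofactor t v + α * (head (v t) * cofactor t w)
        ≈⟨ +-congˡ (*-congˡ (*-congʳ (sym (w≋v t t≢k zero)))) ⟩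
      head (v t) * cofactor t v + α * (head (w t) * cofactor t w) ∎
      where
      minor-linear : det (minor t u) ≈ det (minor t v) + α * det (minor t w)
      minor-linear = det-linear (punchOut t≢k) α (minor-agrees t≢k u≋v) (minor-agrees t≢k w≋v)
        λ r → ≡.subst (λ i → u i (suc r) ≈ v i (suc r) + α * w i (suc r))
                      (≡.sym (punchIn-punchOut t≢k)) (uₖ (suc r))

  sign-adjacent : ∀ {n} {x y : Fin n} → Adjacent x y → sign y ≈ - sign x
  sign-adjacent zero    = refl
  sign-adjacent (suc a) = -‿cong (sign-adjacent a)

  sign-square : ∀ {n} (t : Fin n) → sign t * sign t ≈ 1#
  sign-square zero    = *-identityˡ 1#
  sign-square (suc t) = begin
    - sign t * - sign t      ≈⟨ -‿distribˡ-* (sign t) (- sign t) ⟨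
    - (sign t * - sign t)    ≈⟨ -‿cong (-‿distribʳ-* (sign t) (sign t)) ⟨
    - - (sign t * sign t)    ≈⟨ -‿involutive _ ⟩
    sign t * sign t          ≈⟨ sign-square t ⟩
    1#                       ∎

  det-adjacent-equal : ∀ {m} {v : Fin m → Fin m → Carrier} {x y} → Adjacent x y → v x ≋ v y → det v ≈ 0#
  det-adjacent-equal {zero} {x = ()}
  det-adjacent-equal {suc m} {v} {x} {y} x~y vₓ≋vᵧ = begin
    det v        ≈⟨ sum-pair (adjacent⇒≢ x~y) others ⟩
    T x + T y    ≈⟨ +-congˡ opposite ⟩
    T x + - T x  ≈⟨ -‿inverseʳ (T x) ⟩
    0#           ∎
    where
    T : Fin (suc m) → Carrier
    T t = head (v t) * cofactor t v
    same-minor : ∀ j → minor y v j ≋ minor x v j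
    same-minor j r with punchIn-adjacent x~y j
    ... | inj₁ eq         = reflexive (≡.cong (λ i → v i (suc r)) (≡.sym eq))
    ... | inj₂ (eq , eq′) = begin
      v (punchIn y j) (suc r)  ≡⟨ ≡.cong (λ i → v i (suc r)) eq′ ⟩
      v x (suc r)              ≈⟨ vₓ≋vᵧ (suc r) ⟩
      v y (suc r)              ≡⟨ ≡.cong (λ i → v i (suc r)) (≡.sym eq) ⟩
      v (punchIn x j) (suc r)  ∎
    opposite : T y ≈ - T x
    opposite = begin
      head (v y) * (sign y * det (minor y v))
        ≈⟨ *-cong (sym (vₓ≋vᵧ zero)) (*-cong (sign-adjacent x~y) (det-cong same-minor)) ⟩
      head (v x) * (- sign x * det (minor x v))  ≈⟨ *-congˡ (sym (-‿distribˡ-* _ _)) ⟩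
      head (v x) * - (sign x * det (minor x v))  ≈⟨ sym (-‿distribʳ-* _ _) ⟩
      - T x                                      ∎
    others : ∀ t → t ≢ x → t ≢ y → T t ≈ 0#
    others t t≢x t≢y with x′ , y′ , x′~y′ , eq , eq′ ← adjacent-punchOut x~y t≢x t≢y = begin
      head (v t) * (sign t * det (minor t v))  ≈⟨ *-congˡ (*-congˡ (det-adjacent-equal x′~y′ equal)) ⟩
      head (v t) * (sign t * 0#)               ≈⟨ *-congˡ (zeroʳ (sign t)) ⟩
      head (v t) * 0#                          ≈⟨ zeroʳ (head (v t)) ⟩
      0#                                       ∎
      where
      equal : minor t v x′ ≋ minor t v y′
      equal r = begin
        v (punchIn t x′) (suc r)  ≡⟨ ≡.cong (λ i → v i (suc r)) eq ⟩
        v x (suc r)               ≈⟨ vₓ≋vᵧ (suc r) ⟩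
        v y (suc r)               ≡⟨ ≡.cong (λ i → v i (suc r)) (≡.sym eq′) ⟩
        v (punchIn t y′) (suc r)  ∎

  det-replace-additive : ∀ {m} (v : Fin m → Fin m → Carrier) k a b →
                         det (v [ k ]≔ zipWith _+_ a b) ≈ det (v [ k ]≔ a) + det (v [ k ]≔ b)
  det-replace-additive v k a b = begin
    det (v [ k ]≔ zipWith _+_ a b)             ≈⟨ det-linear k 1# untouched untouched replaced ⟩
    det (v [ k ]≔ a) + 1# * det (v [ k ]≔ b)  ≈⟨ +-congˡ (*-identityˡ _) ⟩
    det (v [ k ]≔ a) + det (v [ k ]≔ b)       ∎
    where
    untouched : ∀ {c d} j → j ≢ k → (v [ k ]≔ c) j ≋ (v [ k ]≔ d) j
    untouched j j≢k = ≋-reflexive (≡.trans (updateAt-minimal j k v j≢k) (≡.sym (updateAt-minimal j k v j≢k)))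
    at : ∀ c r → (v [ k ]≔ c) k r ≡ c r
    at c r = ≡.cong-app (updateAt-updates k v) r
    replaced : ∀ r → (v [ k ]≔ zipWith _+_ a b) k r ≈ (v [ k ]≔ a) k r + 1# * (v [ k ]≔ b) k r
    replaced r = begin
      (v [ k ]≔ zipWith _+_ a b) k r            ≡⟨ at (zipWith _+_ a b) r ⟩
      a r + b r                                 ≈⟨ +-congˡ (sym (*-identityˡ (b r))) ⟩
      a r + 1# * b r                            ≡⟨ ≡.cong₂ (λ p q → p + 1# * q) (at a r) (at b r) ⟨
      (v [ k ]≔ a) k r + 1# * (v [ k ]≔ b) k r  ∎

  alternating⇒antisymmetric : ∀ {a} {X : Set a} (_⊕_ : X → X → X) (B : X → X → Carrier) →
    (∀ x x′ y → B (x ⊕ x′) y ≈ B x y + B x′ y) → (∀ x y y′ → B x (y ⊕ y′) ≈ B x y + B x y′) →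
    (∀ x → B x x ≈ 0#) → ∀ x y → B x y ≈ - B y x
  alternating⇒antisymmetric _⊕_ B additiveˡ additiveʳ alternating x y = +-inverseʳ-unique (B y x) (B x y) (begin
    B y x + B x y                              ≈⟨ +-cong (+-identityˡ _) (+-identityʳ _) ⟨
    (0# + B y x) + (B x y + 0#)                ≈⟨ +-cong (+-congʳ (alternating y)) (+-congˡ (alternating x)) ⟨
    (B y y + B y x) + (B x y + B x x)          ≈⟨ +-cong (additiveʳ y y x) (additiveʳ x y x) ⟨
    B y (y ⊕ x) + B x (y ⊕ x)                  ≈⟨ additiveˡ y x (y ⊕ x) ⟨
    B (y ⊕ x) (y ⊕ x)                          ≈⟨ alternating (y ⊕ x) ⟩
    0#                                         ∎)

  det-swap-adjacent : ∀ {m} (v : Fin m → Fin m → Carrier) {x y} → Adjacent x y →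
                      det v ≈ - det ((v [ x ]≔ v y) [ y ]≔ v x)
  det-swap-adjacent v {x} {y} x~y = begin
    det v              ≈⟨ det-cong (λ j → ≋-reflexive (≡.sym (unchanged j))) ⟩
    B (v x) (v y)      ≈⟨ alternating⇒antisymmetric (zipWith _+_) B additiveˡ additiveʳ alternating (v x) (v y) ⟩
    - B (v y) (v x)    ∎
    where
    x≢y = adjacent⇒≢ x~y
    B : (Fin _ → Carrier) → (Fin _ → Carrier) → Carrier
    B a b = det ((v [ x ]≔ a) [ y ]≔ b)
    commute : ∀ a b → ((v [ x ]≔ a) [ y ]≔ b) ≗ ((v [ y ]≔ b) [ x ]≔ a)
    commute a b = updateAt-commutes y x (x≢y ∘ ≡.sym) v
    additiveˡ : ∀ a a′ b → B (zipWith _+_ a a′) b ≈ B a b + B a′ b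
    additiveˡ a a′ b = begin
      B (zipWith _+_ a a′) b
        ≈⟨ det-cong (≋-reflexive ∘ commute _ b) ⟩
      det ((v [ y ]≔ b) [ x ]≔ zipWith _+_ a a′)
        ≈⟨ det-replace-additive (v [ y ]≔ b) x a a′ ⟩
      det ((v [ y ]≔ b) [ x ]≔ a) + det ((v [ y ]≔ b) [ x ]≔ a′)
        ≈⟨ +-cong (det-cong (≋-reflexive ∘ commute a b)) (det-cong (≋-reflexive ∘ commute a′ b)) ⟨
      B a b + B a′ b ∎
    additiveʳ : ∀ a b b′ → B a (zipWith _+_ b b′) ≈ B a b + B a b′
    additiveʳ a = det-replace-additive (v [ x ]≔ a) y
    alternating : ∀ a → B a a ≈ 0#
    alternating a = det-adjacent-equal x~y (≋-reflexive (≡.trans (updateAt-minimal x y _ x≢y)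
      (≡.trans (updateAt-updates x v) (≡.sym (updateAt-updates y (v [ x ]≔ a))))))
    unchanged : ((v [ x ]≔ v x) [ y ]≔ v y) ≗ v
    unchanged j = ≡.trans (updateAt-id-local y (v [ x ]≔ v x) (≡.sym (updateAt-minimal y x v (x≢y ∘ ≡.sym))) j)
                          (updateAt-id-local x v ≡.refl j)

  -- Swapping x with its neighbour p moves the repeated column one step closer to y.
  det-equal-adjacent⁺ : ∀ {m} (v : Fin m → Fin m → Carrier) {x y} → TransClosure Adjacent x y →
                        v x ≋ v y → det v ≈ 0#
  det-equal-adjacent⁺ v [ x~y ]                        vₓ≋vᵧ = det-adjacent-equal x~y vₓ≋vᵧ
  det-equal-adjacent⁺ v {x} {y} (_∷_ {y = p} x~p p~⁺y) vₓ≋vᵧ = begin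
    det v    ≈⟨ det-swap-adjacent v x~p ⟩
    - det w  ≈⟨ -‿cong (det-equal-adjacent⁺ w p~⁺y wₚ≋wᵧ) ⟩
    - 0#     ≈⟨ -0#≈0# ⟩
    0#       ∎
    where
    w = (v [ x ]≔ v p) [ p ]≔ v x
    y≢p : y ≢ p
    y≢p = <⇒≢ (adjacent⁺⇒< p~⁺y) ∘ ≡.sym
    y≢x : y ≢ x
    y≢x = <⇒≢ (<-trans (adjacent⇒< x~p) (adjacent⁺⇒< p~⁺y)) ∘ ≡.sym
    wₚ≋wᵧ : w p ≋ w y
    wₚ≋wᵧ = ≋-trans (≋-reflexive (updateAt-updates p (v [ x ]≔ v p))) (≋-trans vₓ≋vᵧ
              (≋-reflexive (≡.sym (≡.trans (updateAt-minimal y p _ y≢p) (updateAt-minimal y x v y≢x)))))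

  det-equal-columns : ∀ {m} (v : Fin m → Fin m → Carrier) {x y} → x ≢ y → v x ≋ v y → det v ≈ 0#
  det-equal-columns v {x} {y} x≢y vₓ≋vᵧ with <-cmp x y
  ... | tri< x<y _ _ = det-equal-adjacent⁺ v (<⇒adjacent⁺ x<y) vₓ≋vᵧ
  ... | tri≈ _ x≡y _ = contradiction x≡y x≢y
  ... | tri> _ _ y<x = det-equal-adjacent⁺ v (<⇒adjacent⁺ y<x) (≋-sym vₓ≋vᵧ)

  addColumn : ∀ {m n} → (Fin n → Fin m → Carrier) → Fin n → Carrier → Fin n → Fin n → Fin m → Carrier
  addColumn v t α k = v [ t ]≔ (λ r → v t r + α * v k r)

  det-addColumn : ∀ {m} (v : Fin m → Fin m → Carrier) {t k} α → t ≢ k → det (addColumn v t α k) ≈ det v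
  det-addColumn v {t} {k} α t≢k = begin
    det (addColumn v t α k)        ≈⟨ det-linear t α untouched untouched replaced ⟩
    det v + α * det (v [ t ]≔ v k)  ≈⟨ +-congˡ (*-congˡ (det-equal-columns _ t≢k repeated)) ⟩
    det v + α * 0#                 ≈⟨ +-congˡ (zeroʳ α) ⟩
    det v + 0#                     ≈⟨ +-identityʳ (det v) ⟩
    det v                          ∎
    where
    untouched : ∀ {c} j → j ≢ t → (v [ t ]≔ c) j ≋ v j
    untouched j j≢t = ≋-reflexive (updateAt-minimal j t v j≢t)
    replaced : ∀ r → addColumn v t α k t r ≈ v t r + α * (v [ t ]≔ v k) t r
    replaced r = reflexive (≡.trans (≡.cong-app (updateAt-updates t v) r)
                                    (≡.cong (λ c → v t r + α * c r) (≡.sym (updateAt-updates t v))))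
    repeated : (v [ t ]≔ v k) t ≋ (v [ t ]≔ v k) k
    repeated = ≋-reflexive (≡.trans (updateAt-updates t v) (≡.sym (updateAt-minimal k t v (t≢k ∘ ≡.sym))))

  RowCleared : ∀ {m n} → Fin n → (Fin n → Fin (suc m) → Carrier) → Set ℓ
  RowCleared k v = ∀ t → t ≢ k → head (v t) ≈ 0#

  det-cleared-row : ∀ {m} (v : Fin (suc m) → Fin (suc m) → Carrier) k → RowCleared k v →
                    det v ≈ head (v k) * cofactor k v
  det-cleared-row v k cleared = sum-single k λ t t≢k → trans (*-congʳ (cleared t t≢k)) (zeroˡ (cofactor t v))

  det-ones-row : ∀ {m} (v : Fin (suc m) → Fin (suc m) → Carrier) →
                 (∀ t → head (v t) ≈ 1#) → det v ≈ sum λ t → cofactor t v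
  det-ones-row v v₀≈1 = sum-cong-≋ λ t → trans (*-congʳ (v₀≈1 t)) (*-identityˡ (cofactor t v))

  PivotOp : ∀ {m n} → Fin n → Rel (Fin n → Fin m → Carrier) c
  PivotOp k v w = ∃₂ λ t α → t ≢ k × w ≡ addColumn v t α k

  det-pivotOps : ∀ {m} {k : Fin m} {v w} → Star (PivotOp k) v w → det w ≈ det v
  det-pivotOps ε                                  = refl
  det-pivotOps ((t , α , t≢k , ≡.refl) ◅ ops) = trans (det-pivotOps ops) (det-addColumn _ α t≢k)

  pivotOps-pivot : ∀ {m n} {k : Fin n} {v w : Fin n → Fin m → Carrier} → Star (PivotOp k) v w → w k ≡ v k
  pivotOps-pivot ε                                  = ≡.refl
  pivotOps-pivot {k = k} {v} ((t , α , t≢k , ≡.refl) ◅ ops) =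
    ≡.trans (pivotOps-pivot ops) (updateAt-minimal k t v (t≢k ∘ ≡.sym))

module FieldProperties {c ℓ : Level} (F : Field c ℓ) where

  open Field F
  open import Algebra.Properties.Ring ring using (-‿distribˡ-*)
  open import Relation.Binary.Reasoning.Setoid setoid

  1≉0 : ¬ 1# ≈ 0#
  1≉0 = 0#≉1# ∘ sym

  *-nonzero : ∀ {x y} → ¬ x ≈ 0# → ¬ y ≈ 0# → ¬ x * y ≈ 0#
  *-nonzero {x} {y} x≉0 y≉0 xy≈0 with x⁻¹ , xx⁻¹≈1 ← inverse x x≉0 = y≉0 (begin
    y                ≈⟨ *-identityˡ y ⟨
    1# * y           ≈⟨ *-congʳ (trans (sym xx⁻¹≈1) (*-comm x x⁻¹)) ⟩
    (x⁻¹ * x) * y    ≈⟨ *-assoc x⁻¹ x y ⟩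
    x⁻¹ * (x * y)    ≈⟨ *-congˡ xy≈0 ⟩
    x⁻¹ * 0#         ≈⟨ zeroʳ x⁻¹ ⟩
    0#               ∎)

  pivot-cancels : ∀ a {p p⁻¹} → p * p⁻¹ ≈ 1# → a + - (a * p⁻¹) * p ≈ 0#
  pivot-cancels a {p} {p⁻¹} pp⁻¹≈1 = begin
    a + - (a * p⁻¹) * p      ≈⟨ +-congˡ (-‿distribˡ-* (a * p⁻¹) p) ⟨
    a + - ((a * p⁻¹) * p)    ≈⟨ +-congˡ (-‿cong (*-assoc a p⁻¹ p)) ⟩
    a + - (a * (p⁻¹ * p))    ≈⟨ +-congˡ (-‿cong (*-congˡ (trans (*-comm p⁻¹ p) pp⁻¹≈1))) ⟩
    a + - (a * 1#)           ≈⟨ +-congˡ (-‿cong (*-identityʳ a)) ⟩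
    a + - a                  ≈⟨ -‿inverseʳ a ⟩
    0#                       ∎

  square-one⇒nonzero : ∀ {x} → x * x ≈ 1# → ¬ x ≈ 0#
  square-one⇒nonzero {x} x²≈1 x≈0 = 1≉0 (begin
    1#       ≈⟨ x²≈1 ⟨
    x * x    ≈⟨ *-congˡ x≈0 ⟩
    x * 0#   ≈⟨ zeroʳ x ⟩
    0#       ∎)

module Independence {c ℓ : Level} (F : Field c ℓ) where

  open Field F hiding (zero)
  open Determinant commutativeRing
  open FieldProperties F
  open CommutativeMonoidSum +-commutativeMonoid using (sum-zero; sum-single; sum-update)
  open import Algebra.Properties.Semiring.Sum semiring
    using (sum; sum-cong-≋; ∑-comm; *-distribʳ-sum)
  open import Data.Vec.Functional.Relation.Binary.Equality.Setoid setoid using (_≋_)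
  open import Relation.Binary.Reasoning.Setoid setoid

  Σ≡sum : ∀ n (f : Fin n → Carrier) → Σ[_] F n f ≡ sum f
  Σ≡sum zero    f = ≡.refl
  Σ≡sum (suc n) f = ≡.cong (f zero +_) (Σ≡sum n (f ∘ suc))

  Independent : ∀ {m n} → (Fin m → Fin n → Carrier) → Set (c ⊔ ℓ)
  Independent = LinearlyIndependent F

  independent-sum : ∀ {m n} {v : Fin m → Fin n → Carrier} → Independent v →
                    ∀ λs → (∀ r → sum (λ i → λs i * v i r) ≈ 0#) → ∀ i → λs i ≈ 0#
  independent-sum {m} li λs combination = li λs λ r → trans (reflexive (Σ≡sum m _)) (combination r)

  mk-independent : ∀ {m n} {v : Fin m → Fin n → Carrier} →
                   (∀ λs → (∀ r → sum (λ i → λs i * v i r) ≈ 0#) → ∀ i → λs i ≈ 0#) → Independent v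
  mk-independent {m} trivial λs combination = trivial λs λ r → trans (reflexive (≡.sym (Σ≡sum m _))) (combination r)

  independent-cong : ∀ {m n} {u v : Fin m → Fin n → Carrier} → (∀ j → u j ≋ v j) → Independent v → Independent u
  independent-cong u≋v li = mk-independent λ λs combination → independent-sum li λs λ r →
    trans (sum-cong-≋ λ i → *-congˡ (sym (u≋v i r))) (combination r)

  independent-∘ : ∀ {m n k} {v : Fin m → Fin n → Carrier} {ρ : Fin k → Fin m} →
                  Injective _≡_ _≡_ ρ → Independent v → Independent (v ∘ ρ)
  independent-∘ {m} {n} {k} {v} {ρ} ρ-injective li = mk-independent λ λs combination j → begin
    λs j          ≈⟨ pulled-back λs j ⟨
    μ λs (ρ j)    ≈⟨ independent-sum li (μ λs) (pushed-forward λs combination) (ρ j) ⟩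
    0#            ∎
    where
    pick : Fin k → Fin m → Carrier → Carrier
    pick j i x with ρ j ≟ i
    ... | yes _ = x
    ... | no  _ = 0#
    pick-yes : ∀ {j x} → pick j (ρ j) x ≈ x
    pick-yes {j} with ρ j ≟ ρ j
    ... | yes _      = refl
    ... | no  ρj≢ρj = contradiction ≡.refl ρj≢ρj
    pick-no : ∀ {j i x} → ρ j ≢ i → pick j i x ≈ 0#
    pick-no {j} {i} ρj≢i with ρ j ≟ i
    ... | yes ρj≡i = contradiction ρj≡i ρj≢i
    ... | no  _    = refl
    μ : (Fin k → Carrier) → Fin m → Carrier
    μ λs i = sum λ j → pick j i (λs j)
    pulled-back : ∀ λs j → μ λs (ρ j) ≈ λs j
    pulled-back λs j = trans (sum-single j (λ j′ j′≢j → pick-no (j′≢j ∘ ρ-injective))) pick-yes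
    pushed-forward : ∀ λs → (∀ r → sum (λ j → λs j * v (ρ j) r) ≈ 0#) →
                     ∀ r → sum (λ i → μ λs i * v i r) ≈ 0#
    pushed-forward λs combination r = begin
      sum (λ i → μ λs i * v i r)                        ≈⟨ sum-cong-≋ (λ i → *-distribʳ-sum (v i r) (λ j → pick j i (λs j))) ⟩
      sum (λ i → sum λ j → pick j i (λs j) * v i r)     ≈⟨ ∑-comm (λ i j → pick j i (λs j) * v i r) ⟩
      sum (λ j → sum λ i → pick j i (λs j) * v i r)     ≈⟨ sum-cong-≋ (λ j → sum-single (ρ j) λ i i≢ρj →
                                                             trans (*-congʳ (pick-no (i≢ρj ∘ ≡.sym))) (zeroˡ _)) ⟩
      sum (λ j → pick j (ρ j) (λs j) * v (ρ j) r)       ≈⟨ sum-cong-≋ (λ j → *-congʳ (pick-yes {j})) ⟩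
      sum (λ j → λs j * v (ρ j) r)                      ≈⟨ combination r ⟩
      0#                                                ∎


  independent-tail : ∀ {m n} {v : Fin m → Fin (suc n) → Carrier} →
                     (∀ t → head (v t) ≈ 0#) → Independent v → Independent (tail ∘ v)
  independent-tail {v = v} v₀≈0 li = mk-independent λ λs combination → independent-sum li λs λ
    { zero    → sum-zero λ i → trans (*-congˡ (v₀≈0 i)) (zeroʳ (λs i))
    ; (suc r) → combination r }

  independent-minor : ∀ {m n} {v : Fin (suc m) → Fin (suc n) → Carrier} k →
                      RowCleared k v → Independent v → Independent (minor k v)
  independent-minor {v = v} k cleared li =
    independent-tail {v = removeAt v k} (λ j → cleared _ (punchInᵢ≢i k j))
                     (independent-∘ {v = v} (punchIn-injective k _ _) li)

  independent-addColumn : ∀ {m n} {v : Fin m → Fin n → Carrier} {t k} α → t ≢ k →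
                          Independent v → Independent (addColumn v t α k)
  independent-addColumn {v = v} {t} {k} α t≢k li = mk-independent λ λs → vanish λs ∘ λ′≈0 λs
    where
    open import Algebra.Solver.Ring.NaturalCoefficients.Default commutativeSemiring
    λ′ : (Fin _ → Carrier) → Fin _ → Carrier
    λ′ λs = λs [ k ]≔ (λs k + α * λs t)
    λ′-other : ∀ λs {i} → i ≢ k → λ′ λs i ≈ λs i
    λ′-other λs i≢k = reflexive (updateAt-minimal _ k λs i≢k)
    λ′-pivot : ∀ λs → λ′ λs k ≈ λs k + α * λs t
    λ′-pivot λs = reflexive (updateAt-updates k λs)
    same-combination : ∀ λs r → sum (λ i → λ′ λs i * v i r) ≈ sum (λ i → λs i * addColumn v t α k i r)
    same-combination λs r = begin
      sum (λ i → λ′ λs i * v i r)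
        ≈⟨ sum-update k _ (λ i i≢k → *-congʳ (λ′-other λs i≢k)) (trans (*-congʳ (λ′-pivot λs))
             (solve 4 (λ a α b x → (a :+ α :* b) :* x := α :* b :* x :+ a :* x) refl _ α _ _)) ⟩
      (α * λs t) * v k r + sum (λ i → λs i * v i r)
        ≈⟨ +-congʳ (solve 3 (λ α b x → α :* b :* x := b :* (α :* x)) refl α _ _) ⟩
      λs t * (α * v k r) + sum (λ i → λs i * v i r)
        ≈⟨ sum-update t _ (λ i i≢t → *-congˡ (reflexive (≡.cong-app (updateAt-minimal i t v i≢t) r))) (trans
             (*-congˡ (reflexive (≡.cong-app (updateAt-updates t v) r)))
             (solve 4 (λ b x α y → b :* (x :+ α :* y) := b :* (α :* y) :+ b :* x) refl _ _ α _)) ⟨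
      sum (λ i → λs i * addColumn v t α k i r) ∎
    λ′≈0 : ∀ λs → (∀ r → sum (λ i → λs i * addColumn v t α k i r) ≈ 0#) → ∀ i → λ′ λs i ≈ 0#
    λ′≈0 λs combination = independent-sum li (λ′ λs) λ r → trans (same-combination λs r) (combination r)
    vanish : ∀ λs → (∀ i → λ′ λs i ≈ 0#) → ∀ i → λs i ≈ 0#
    vanish λs λ′≈0 i with i ≟ k
    ... | no i≢k     = trans (sym (λ′-other λs i≢k)) (λ′≈0 i)
    ... | yes ≡.refl = begin
      λs k               ≈⟨ +-identityʳ (λs k) ⟨
      λs k + 0#          ≈⟨ +-congˡ (zeroʳ α) ⟨
      λs k + α * 0#      ≈⟨ +-congˡ (*-congˡ (trans (sym (λ′-other λs t≢k)) (λ′≈0 t))) ⟨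
      λs k + α * λs t    ≈⟨ λ′-pivot λs ⟨
      λ′ λs k            ≈⟨ λ′≈0 k ⟩
      0#                 ∎

  independent-pivotOps : ∀ {m n} {k : Fin n} {v w : Fin n → Fin m → Carrier} →
                         Star (PivotOp k) v w → Independent v → Independent w
  independent-pivotOps ε                                  = id
  independent-pivotOps ((t , α , t≢k , ≡.refl) ◅ ops) = independent-pivotOps ops ∘ independent-addColumn α t≢k

  clear-pivot-row : ∀ {m n} {k : Fin n} (v : Fin n → Fin (suc m) → Carrier) → ¬ head (v k) ≈ 0# →
                    ∃ λ w → Star (PivotOp k) v w × RowCleared k w
  clear-pivot-row {m} {n} {k} v pivot = clear (allFin n) v pivot λ t _ → inj₁ (∈-allFin t)
    where
    Family = Fin n → Fin (suc m) → Carrier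
    -- L lists the columns whose first entry may still be nonzero.
    clear : ∀ (L : List (Fin n)) (v : Family) → ¬ head (v k) ≈ 0# →
            (∀ t → t ≢ k → t ∈ L ⊎ head (v t) ≈ 0#) → ∃ λ w → Star (PivotOp k) v w × RowCleared k w
    clear []      v _ pending = v , ε , λ t t≢k → [ (λ ()) , id ]′ (pending t t≢k)
    clear (s ∷ L) v pivot pending with s ≟ k
    ... | yes ≡.refl = clear L v pivot λ t t≢k →
      Sum.map₁ (λ { (here t≡k) → contradiction t≡k t≢k ; (there t∈L) → t∈L }) (pending t t≢k)
    ... | no s≢k = let w′ , ops , cleared = clear L w pivot′ pending′ in
      w′ , (s , α , s≢k , ≡.refl) ◅ ops , cleared
      where
      p⁻¹ = proj₁ (inverse (head (v k)) pivot)
      pp⁻¹≈1 = proj₂ (inverse (head (v k)) pivot)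
      α = - (head (v s) * p⁻¹)
      w = addColumn v s α k
      pivot′ : ¬ head (w k) ≈ 0#
      pivot′ = pivot ∘ trans (reflexive (≡.sym (≡.cong-app (updateAt-minimal k s v (s≢k ∘ ≡.sym)) zero)))
      cancelled : head (w s) ≈ 0#
      cancelled = trans (reflexive (≡.cong-app (updateAt-updates s v) zero)) (pivot-cancels (head (v s)) pp⁻¹≈1)
      pending′ : ∀ t → t ≢ k → t ∈ L ⊎ head (w t) ≈ 0#
      pending′ t t≢k with t ≟ s
      ... | yes ≡.refl = inj₂ cancelled
      ... | no t≢s = Sum.map (λ { (here t≡s) → contradiction t≡s t≢s ; (there t∈L) → t∈L })
                             (trans (reflexive (≡.cong-app (updateAt-minimal t s v t≢s) zero)))
                             (pending t t≢k)

  -- Gaussian elimination on the first row.  Whether an entry vanishes is undecidable, so the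
  -- case split runs under a double negation, which suffices because the goals are negative.
  too-many : ∀ m (v : Fin (suc m) → Fin m → Carrier) → ¬ Independent v
  too-many zero    v li = 1≉0 (independent-sum {v = v} li (λ _ → 1#) (λ ()) zero)
  too-many (suc m) v li = finite-excluded-middle _ (λ t → head (v t) ≈ 0#) λ
    { (inj₁ v₀≈0)        → too-many m (minor zero v) (independent-minor {v = v} zero (λ t _ → v₀≈0 t) li)
    ; (inj₂ (k , pivot)) → let w , ops , cleared = clear-pivot-row v pivot in
        too-many m (minor k w) (independent-minor {v = w} k cleared (independent-pivotOps ops li)) }

  det-nonzero : ∀ {m} (v : Fin m → Fin m → Carrier) → Independent v → ¬ det v ≈ 0#
  det-nonzero {zero}  v li = 1≉0
  det-nonzero {suc m} v li det≈0 = finite-excluded-middle _ (λ t → head (v t) ≈ 0#) λ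
    { (inj₁ v₀≈0)        → too-many m (tail ∘ v) (independent-tail {v = v} v₀≈0 li)
    ; (inj₂ (k , pivot)) → let w , ops , cleared = clear-pivot-row v pivot in
        *-nonzero (pivot ∘ trans (reflexive (≡.sym (≡.cong-app (pivotOps-pivot ops) zero))))
                  (*-nonzero (square-one⇒nonzero (sign-square k))
                             (det-nonzero (minor k w) (independent-minor {v = w} k cleared (independent-pivotOps ops li))))
                  (begin
                     head (w k) * cofactor k w  ≈⟨ det-cleared-row w k cleared ⟨
                     det w                      ≈⟨ det-pivotOps ops ⟩
                     det v                      ≈⟨ det≈0 ⟩
                     0#                         ∎) }

module CofactorPolynomial {c ℓ : Level} (F : Field c ℓ) where

  open Field F hiding (zero)
  open Determinant commutativeRing using (sign; sign-square; det; cofactor)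
  open FieldProperties F using (square-one⇒nonzero)
  open import Algebra.Properties.Semiring.Sum semiring using (sum; sum-cong-≋)
  open import Algebra.Properties.CommutativeSemigroup *-commutativeSemigroup using () renaming (interchange to *-interchange)
  open import Relation.Binary.Reasoning.Setoid setoid

  module ℕSum = CommutativeMonoidSum ℕ.+-0-commutativeMonoid
  module ΠSum = CommutativeMonoidSum *-commutativeMonoid

  sumℕ≡sum : ∀ n (f : Fin n → ℕ) → sumℕ n f ≡ ℕSum.sum f
  sumℕ≡sum zero    f = ≡.refl
  sumℕ≡sum (suc n) f = ≡.cong (f zero ℕ.+_) (sumℕ≡sum n (f ∘ suc))

  Π≡product : ∀ n (f : Fin n → Carrier) → Π[_] F n f ≡ ΠSum.sum f
  Π≡product zero    f = ≡.refl
  Π≡product (suc n) f = ≡.cong (f zero *_) (Π≡product n (f ∘ suc))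

  sumℕ-update : ∀ {n} {f g : Fin n → ℕ} k x → (∀ i → i ≢ k → g i ≡ f i) → g k ≡ x ℕ.+ f k →
                sumℕ n g ≡ x ℕ.+ sumℕ n f
  sumℕ-update {n} {f} {g} k x g≡f gₖ =
    ≡.trans (sumℕ≡sum n g) (≡.trans (ℕSum.sum-update k x g≡f gₖ) (≡.cong (x ℕ.+_) (≡.sym (sumℕ≡sum n f))))

  sumℕ-cong : ∀ n {f g : Fin n → ℕ} → (∀ i → f i ≡ g i) → sumℕ n f ≡ sumℕ n g
  sumℕ-cong zero    f≡g = ≡.refl
  sumℕ-cong (suc n) f≡g = ≡.cong₂ ℕ._+_ (f≡g zero) (sumℕ-cong n (f≡g ∘ suc))

  sumℕ-zeros : ∀ n {f : Fin n → ℕ} → (∀ i → f i ≡ 0) → sumℕ n f ≡ 0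
  sumℕ-zeros zero    f≡0 = ≡.refl
  sumℕ-zeros (suc n) f≡0 = ≡.cong₂ ℕ._+_ (f≡0 zero) (sumℕ-zeros n (f≡0 ∘ suc))

  Π-update : ∀ {n} {f g : Fin n → Carrier} k x → (∀ i → i ≢ k → g i ≈ f i) → g k ≈ x * f k →
             Π[_] F n g ≈ x * Π[_] F n f
  Π-update {n} {f} {g} k x g≈f gₖ = begin
    Π[_] F n g        ≡⟨ Π≡product n g ⟩
    ΠSum.sum g        ≈⟨ ΠSum.sum-update k x g≈f gₖ ⟩
    x * ΠSum.sum f    ≡⟨ ≡.cong (x *_) (Π≡product n f) ⟨
    x * Π[_] F n f    ∎

  Π-cong : ∀ n {f g : Fin n → Carrier} → (∀ i → f i ≈ g i) → Π[_] F n f ≈ Π[_] F n g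
  Π-cong zero    f≈g = refl
  Π-cong (suc n) f≈g = *-cong (f≈g zero) (Π-cong n (f≈g ∘ suc))

  Π-ones : ∀ n {f : Fin n → Carrier} → (∀ i → f i ≈ 1#) → Π[_] F n f ≈ 1#
  Π-ones zero    f≈1 = refl
  Π-ones (suc n) f≈1 = trans (*-cong (f≈1 zero) (Π-ones n (f≈1 ∘ suc))) (*-identityˡ 1#)

  sign-coefficient : ∀ {n} (t : Fin n) {x} → x * x ≈ 1# → (sign t * x) * (sign t * x) ≈ 1#
  sign-coefficient t {x} x²≈1 = begin
    sign t * x * (sign t * x)    ≈⟨ *-interchange (sign t) x (sign t) x ⟩
    sign t * sign t * (x * x)    ≈⟨ *-cong (sign-square t) x²≈1 ⟩
    1# * 1#                      ≈⟨ *-identityˡ 1# ⟩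
    1#                           ∎

  module _ {q : ℕ} where

    zeroExponent : Exponent F q
    zeroExponent r s = 0

    unitExponent : Fin q → Fin q → Exponent F q
    unitExponent a b r s with r ≟ a | s ≟ b
    ... | yes _ | yes _ = 1
    ... | _     | _     = 0

    _⊕_ : Exponent F q → Exponent F q → Exponent F q
    (e ⊕ e′) r s = e r s ℕ.+ e′ r s

    unitExponent-diagonal : ∀ a b → unitExponent a b a b ≡ 1
    unitExponent-diagonal a b with a ≟ a | b ≟ b
    ... | yes _ | yes _   = ≡.refl
    ... | no a≢a | _      = contradiction ≡.refl a≢a
    ... | yes _ | no b≢b  = contradiction ≡.refl b≢b

    unitExponent-offRow : ∀ {a b r} s → r ≢ a → unitExponent a b r s ≡ 0
    unitExponent-offRow {a} {b} {r} s r≢a with r ≟ a | s ≟ b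
    ... | yes r≡a | _     = contradiction r≡a r≢a
    ... | no _    | _     = ≡.refl

    unitExponent-offColumn : ∀ {a b s} r → s ≢ b → unitExponent a b r s ≡ 0
    unitExponent-offColumn {a} {b} {s} r s≢b with r ≟ a | s ≟ b
    ... | _     | yes s≡b = contradiction s≡b s≢b
    ... | yes _ | no _    = ≡.refl
    ... | no _  | no _    = ≡.refl

    evalMonomial-zero : ∀ M → evalMonomial F zeroExponent M ≈ 1#
    evalMonomial-zero M = Π-ones q λ r → Π-ones q λ s → refl

    evalMonomial-unit : ∀ a b e M → evalMonomial F (unitExponent a b ⊕ e) M ≈ M a b * evalMonomial F e M
    evalMonomial-unit a b e M = Π-update a (M a b)
      (λ r r≢a → Π-cong q λ s → reflexive (≡.cong (λ k → M r s ^′ (k ℕ.+ e r s)) (unitExponent-offRow s r≢a)))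
      (Π-update b (M a b)
        (λ s s≢b → reflexive (≡.cong (λ k → M a s ^′ (k ℕ.+ e a s)) (unitExponent-offColumn a s≢b)))
        (reflexive (≡.cong (λ k → M a b ^′ (k ℕ.+ e a b)) (unitExponent-diagonal a b))))
      where _^′_ = _^_ F

    totalDeg-zero : totalDeg F zeroExponent ≡ 0
    totalDeg-zero = sumℕ-zeros q λ r → sumℕ-zeros q λ s → ≡.refl

    totalDeg-unit : ∀ a b e → totalDeg F (unitExponent a b ⊕ e) ≡ suc (totalDeg F e)
    totalDeg-unit a b e = sumℕ-update a 1
      (λ r r≢a → sumℕ-cong q λ s → ≡.cong (ℕ._+ e r s) (unitExponent-offRow s r≢a))
      (sumℕ-update b 1
        (λ s s≢b → ≡.cong (ℕ._+ e a s) (unitExponent-offColumn a s≢b))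
        (≡.cong (ℕ._+ e a b) (unitExponent-diagonal a b)))

    ⊕-nonzeroʳ : ∀ e e′ {r s} → e′ r s ≢ 0 → (e ⊕ e′) r s ≢ 0
    ⊕-nonzeroʳ e e′ e′≢0 = e′≢0 ∘ ℕ.m+n≡0⇒n≡0 (e _ _)

    unit⊕-diagonal : ∀ a b e → (unitExponent a b ⊕ e) a b ≢ 0
    unit⊕-diagonal a b e eq = ℕ.1+n≢0 (≡.trans (≡.cong (ℕ._+ e a b) (≡.sym (unitExponent-diagonal a b))) eq)

    unit⊕-nonzero : ∀ {a b} e {r s} → (unitExponent a b ⊕ e) r s ≢ 0 → (r ≡ a × s ≡ b) ⊎ e r s ≢ 0
    unit⊕-nonzero {a} {b} e {r} {s} nonzero with r ≟ a | s ≟ b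
    ... | yes r≡a | yes s≡b = inj₁ (r≡a , s≡b)
    ... | no _    | _       = inj₂ nonzero
    ... | yes _   | no _    = inj₂ nonzero

    timesEntry : Carrier → Fin q → Fin q → Term F q → Term F q
    timesEntry s a b (x , e) = s * x , unitExponent a b ⊕ e

    scaleTerm : Carrier → Term F q → Term F q
    scaleTerm s (x , e) = s * x , e

    detTerms : ∀ m → (Fin m → Fin q) → (Fin m → Fin q) → List (Term F q)
    detTerms zero    ρ κ = (1# , zeroExponent) ∷ []
    detTerms (suc m) ρ κ = concat (tabulate λ t →
      List.map (timesEntry (sign t) (ρ zero) (κ t)) (detTerms m (ρ ∘ suc) (κ ∘ punchIn t)))

    submatrix : ∀ {m} → (Fin m → Fin q) → (Fin m → Fin q) → Matrix F q → Fin m → Fin m → Carrier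
    submatrix ρ κ M j i = M (ρ i) (κ j)

    evalTerms-++ : ∀ (xs ys : List (Term F q)) M → evalTerms F (xs ++ ys) M ≈ evalTerms F xs M + evalTerms F ys M
    evalTerms-++ []             ys M = sym (+-identityˡ (evalTerms F ys M))
    evalTerms-++ ((x , e) ∷ xs) ys M = trans (+-congˡ (evalTerms-++ xs ys M)) (sym (+-assoc _ _ _))

    evalTerms-blocks : ∀ {n} (B : Fin n → List (Term F q)) M →
                       evalTerms F (concat (tabulate B)) M ≈ sum λ t → evalTerms F (B t) M
    evalTerms-blocks {zero}  B M = refl
    evalTerms-blocks {suc n} B M =
      trans (evalTerms-++ (B zero) (concat (tabulate (B ∘ suc))) M) (+-congˡ (evalTerms-blocks (B ∘ suc) M))

    evalTerms-timesEntry : ∀ s a b (ts : List (Term F q)) M →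
                           evalTerms F (List.map (timesEntry s a b) ts) M ≈ M a b * (s * evalTerms F ts M)
    evalTerms-timesEntry s a b []             M = sym (trans (*-congˡ (zeroʳ s)) (zeroʳ (M a b)))
    evalTerms-timesEntry s a b ((x , e) ∷ ts) M = begin
      s * x * evalMonomial F (unitExponent a b ⊕ e) M + evalTerms F (List.map (timesEntry s a b) ts) M
        ≈⟨ +-cong (*-congˡ (evalMonomial-unit a b e M)) (evalTerms-timesEntry s a b ts M) ⟩
      s * x * (M a b * evalMonomial F e M) + M a b * (s * evalTerms F ts M)
        ≈⟨ solve 5 (λ s x m E R → s :* x :* (m :* E) :+ m :* (s :* R) := m :* (s :* (x :* E :+ R))) refl s x (M a b) _ _ ⟩
      M a b * (s * (x * evalMonomial F e M + evalTerms F ts M)) ∎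
      where open import Algebra.Solver.Ring.NaturalCoefficients.Default commutativeSemiring

    evalTerms-scale : ∀ s (ts : List (Term F q)) M → evalTerms F (List.map (scaleTerm s) ts) M ≈ s * evalTerms F ts M
    evalTerms-scale s []             M = sym (zeroʳ s)
    evalTerms-scale s ((x , e) ∷ ts) M =
      trans (+-cong (*-assoc s x _) (evalTerms-scale s ts M)) (sym (distribˡ s _ _))

    evalTerms-detTerms : ∀ m ρ κ M → evalTerms F (detTerms m ρ κ) M ≈ det (submatrix ρ κ M)
    evalTerms-detTerms zero    ρ κ M = trans (+-identityʳ _) (trans (*-identityˡ _) (evalMonomial-zero M))
    evalTerms-detTerms (suc m) ρ κ M = trans (evalTerms-blocks (λ t → List.map (entry t) (minorTerms t)) M)
      (sum-cong-≋ λ t → trans (evalTerms-timesEntry (sign t) (ρ zero) (κ t) (minorTerms t) M)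
                              (*-congˡ (*-congˡ (evalTerms-detTerms m (ρ ∘ suc) (κ ∘ punchIn t) M))))
      where
      entry = λ t → timesEntry (sign t) (ρ zero) (κ t)
      minorTerms = λ t → detTerms m (ρ ∘ suc) (κ ∘ punchIn t)

    detTerms-all : ∀ {p} (P : ∀ {m} → (Fin m → Fin q) → (Fin m → Fin q) → Term F q → Set p) →
                   (∀ {ρ κ} → P {0} ρ κ (1# , zeroExponent)) →
                   (∀ {m ρ κ} t {x} → P {m} (ρ ∘ suc) (κ ∘ punchIn t) x →
                                      P ρ κ (timesEntry (sign t) (ρ zero) (κ t) x)) →
                   ∀ m ρ κ → All (P ρ κ) (detTerms m ρ κ)
    detTerms-all P base step zero    ρ κ = base ∷ []
    detTerms-all P base step (suc m) ρ κ = All.concat⁺ (All.tabulate⁺ λ t →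
      All.map⁺ (All.map (step t) (detTerms-all P base step m (ρ ∘ suc) (κ ∘ punchIn t))))

    detTerms-nonempty : ∀ m ρ κ → Any (λ _ → ⊤) (detTerms m ρ κ)
    detTerms-nonempty zero    ρ κ = here tt
    detTerms-nonempty (suc m) ρ κ = Any.++⁺ˡ (Any.map⁺ (detTerms-nonempty m (ρ ∘ suc) (κ ∘ punchIn zero)))

    detTerms-degree : ∀ m ρ κ → All (λ x → totalDeg F (proj₂ x) ≡ m) (detTerms m ρ κ)
    detTerms-degree = detTerms-all (λ {m} _ _ x → totalDeg F (proj₂ x) ≡ m) totalDeg-zero
      λ {_} {ρ} {κ} t {x} deg → ≡.trans (totalDeg-unit (ρ zero) (κ t) (proj₂ x)) (≡.cong suc deg)

    detTerms-coefficient : ∀ m ρ κ → All (λ x → proj₁ x * proj₁ x ≈ 1#) (detTerms m ρ κ)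
    detTerms-coefficient = detTerms-all (λ _ _ x → proj₁ x * proj₁ x ≈ 1#) (*-identityˡ 1#) (λ t → sign-coefficient t)

    Support : ∀ {m} → (Fin m → Fin q) → (Fin m → Fin q) → Term F q → Set
    Support ρ κ x = ∀ r s → proj₂ x r s ≢ 0 → (∃ λ i → ρ i ≡ r) × (∃ λ j → κ j ≡ s)

    detTerms-support : ∀ m ρ κ → All (Support ρ κ) (detTerms m ρ κ)
    detTerms-support = detTerms-all Support (λ r s e≢0 → contradiction ≡.refl e≢0) step
      where
      step : ∀ {m} {ρ κ : Fin (suc m) → Fin q} t {x} → Support (ρ ∘ suc) (κ ∘ punchIn t) x →
             Support ρ κ (timesEntry (sign t) (ρ zero) (κ t) x)
      step t {x} support r s e≢0 with unit⊕-nonzero (proj₂ x) e≢0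
      ... | inj₁ (r≡ρ₀ , s≡κₜ) = (zero , ≡.sym r≡ρ₀) , (t , ≡.sym s≡κₜ)
      ... | inj₂ e≢0′          = Product.map (Product.map suc id) (Product.map (punchIn t) id) (support r s e≢0′)

    ColumnsUsed : ∀ {m} → (Fin m → Fin q) → (Fin m → Fin q) → Term F q → Set
    ColumnsUsed ρ κ x = ∀ j → ∃ λ i → proj₂ x (ρ i) (κ j) ≢ 0

    detTerms-columnsUsed : ∀ m ρ κ → All (ColumnsUsed ρ κ) (detTerms m ρ κ)
    detTerms-columnsUsed = detTerms-all ColumnsUsed (λ ()) step
      where
      step : ∀ {m} {ρ κ : Fin (suc m) → Fin q} t {x} → ColumnsUsed (ρ ∘ suc) (κ ∘ punchIn t) x →
             ColumnsUsed ρ κ (timesEntry (sign t) (ρ zero) (κ t) x)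
      step {ρ = ρ} {κ} t {x} used j with t ≟ j
      ... | yes ≡.refl = zero , unit⊕-diagonal (ρ zero) (κ t) (proj₂ x)
      ... | no t≢j     = suc i , ≡.subst (λ j → (unitExponent (ρ zero) (κ t) ⊕ proj₂ x) (ρ (suc i)) (κ j) ≢ 0)
                                        (punchIn-punchOut t≢j) (⊕-nonzeroʳ (unitExponent (ρ zero) (κ t)) (proj₂ x) e≢0)
        where
        i = proj₁ (used (punchOut t≢j))
        e≢0 = proj₂ (used (punchOut t≢j))

    Distinct : Term F q → Term F q → Set
    Distinct x y = ¬ (∀ r s → proj₂ x r s ≡ proj₂ y r s)

    detTerms-distinct : ∀ m {ρ κ} → Injective _≡_ _≡_ ρ → Injective _≡_ _≡_ κ →
                        AllPairs Distinct (detTerms m ρ κ)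
    detTerms-distinct zero    _ _ = [] ∷ []
    detTerms-distinct (suc m) {ρ} {κ} ρ-injective κ-injective = AllPairs-blocks Tag within tagged separated
      where
      block : Fin (suc m) → List (Term F q)
      block t = List.map (timesEntry (sign t) (ρ zero) (κ t)) (detTerms m (ρ ∘ suc) (κ ∘ punchIn t))
      -- Only the block of t contains the entry (ρ zero , κ t).
      Tag : Fin (suc m) → Term F q → Set
      Tag t y = proj₂ y (ρ zero) (κ t) ≢ 0 × (∀ t′ → proj₂ y (ρ zero) (κ t′) ≢ 0 → t′ ≡ t)
      within : ∀ t → AllPairs Distinct (block t)
      within t = AllPairs.map⁺ (AllPairs.map (λ distinct same → distinct λ r s → ℕ.+-cancelˡ-≡ _ _ _ (same r s))
        (detTerms-distinct m (suc-injective ∘ ρ-injective) (punchIn-injective t _ _ ∘ κ-injective)))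
      tagged : ∀ t → All (Tag t) (block t)
      tagged t = All.map⁺ (All.map (λ {x} support → unit⊕-diagonal (ρ zero) (κ t) (proj₂ x) , only x support)
                                (detTerms-support m (ρ ∘ suc) (κ ∘ punchIn t)))
        where
        only : ∀ x → Support (ρ ∘ suc) (κ ∘ punchIn t) x →
               ∀ t′ → (unitExponent (ρ zero) (κ t) ⊕ proj₂ x) (ρ zero) (κ t′) ≢ 0 → t′ ≡ t
        only x support t′ e≢0 with unit⊕-nonzero (proj₂ x) e≢0
        ... | inj₁ (_ , κₜ′≡κₜ) = κ-injective κₜ′≡κₜ
        ... | inj₂ e≢0′ with (i , ρᵢ≡ρ₀) , _ ← support _ _ e≢0′ = contradiction (ρ-injective ρᵢ≡ρ₀) λ ()
      separated : ∀ {t t′} → t ≢ t′ → ∀ {x y} → Tag t x → Tag t′ y → Distinct x y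
      separated {t} t≢t′ (xₜ≢0 , _) (_ , only) same = t≢t′ (only t (xₜ≢0 ∘ ≡.trans (same (ρ zero) (κ t))))

  cofactorBlock : ∀ p → Fin (suc p) → List (Term F (suc p))
  cofactorBlock p t = List.map (scaleTerm (sign t)) (detTerms p suc (punchIn t))

  cofactorTerms : ∀ p → List (Term F (suc p))
  cofactorTerms p = concat (tabulate (cofactorBlock p))

  cofactorTerms-distinct : ∀ p → AllPairs Distinct (cofactorTerms p)
  cofactorTerms-distinct p = AllPairs-blocks Tag within tagged separated
    where
    -- Only the block of t avoids column t.
    Tag : Fin (suc p) → Term F (suc p) → Set
    Tag t y = (∀ r → ¬ proj₂ y r t ≢ 0) × (∀ t′ → t′ ≢ t → ∃ λ r → proj₂ y r t′ ≢ 0)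
    within : ∀ t → AllPairs Distinct (cofactorBlock p t)
    within t = AllPairs.map⁺ {f = scaleTerm (sign t)} (detTerms-distinct p suc-injective (punchIn-injective t _ _))
    tagged : ∀ t → All (Tag t) (cofactorBlock p t)
    tagged t = All.map⁺ {f = scaleTerm (sign t)}
      (All.zipWith (λ {y} (support , used) → unused {y} support , uses {y} used)
                   (detTerms-support p suc (punchIn t) , detTerms-columnsUsed p suc (punchIn t)))
      where
      unused : ∀ {y} → Support suc (punchIn t) y → ∀ r → ¬ proj₂ y r t ≢ 0
      unused support r e≢0 = punchInᵢ≢i t _ (proj₂ (proj₂ (support r t e≢0)))
      uses : ∀ {y} → ColumnsUsed suc (punchIn t) y → ∀ t′ → t′ ≢ t → ∃ λ r → proj₂ y r t′ ≢ 0
      uses {y} used t′ t′≢t with i , e≢0 ← used (punchOut (t′≢t ∘ ≡.sym)) =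
        suc i , ≡.subst (λ s → proj₂ y (suc i) s ≢ 0) (punchIn-punchOut (t′≢t ∘ ≡.sym)) e≢0
    separated : ∀ {t t′} → t ≢ t′ → ∀ {x y} → Tag t x → Tag t′ y → Distinct x y
    separated {t} {t′} t≢t′ (_ , uses) (unused , _) same with r , e≢0 ← uses t′ (t≢t′ ∘ ≡.sym) =
      unused r (e≢0 ∘ ≡.trans (same r t′))

  cofactorPolynomial : ∀ p → Polynomial F (suc p)
  cofactorPolynomial p = record
    { terms    = cofactorTerms p
    ; nonzero  = All.concat⁺ (All.tabulate⁺ λ t → All.map⁺ {f = scaleTerm (sign t)}
                   (All.map (square-one⇒nonzero ∘ sign-coefficient t) (detTerms-coefficient p suc (punchIn t))))
    ; distinct = cofactorTerms-distinct p
    }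

  cofactorPolynomial-degree : ∀ p → HasDegree F (cofactorPolynomial p) p
  cofactorPolynomial-degree p = All.map ℕ.≤-reflexive degree
                              , nonempty-All⇒Any (Any.++⁺ˡ (Any.map⁺ (detTerms-nonempty p suc (punchIn zero)))) degree
    where
    degree : All (λ x → totalDeg F (proj₂ x) ≡ p) (cofactorTerms p)
    degree = All.concat⁺ (All.tabulate⁺ λ t → All.map⁺ {f = scaleTerm (sign t)} (detTerms-degree p suc (punchIn t)))

  eval-cofactorPolynomial : ∀ p M → eval F (cofactorPolynomial p) M ≈ sum λ t → cofactor t (column F M)
  eval-cofactorPolynomial p M = trans (evalTerms-blocks (cofactorBlock p) M) (sum-cong-≋ λ t →
    trans (evalTerms-scale (sign t) (detTerms p suc (punchIn t)) M) (*-congˡ (evalTerms-detTerms p suc (punchIn t) M)))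

module ColoredMatrix {c ℓ : Level} (F : Field c ℓ) {p : ℕ} {col : Fin (suc p) → Vector F (suc p)}
                     (palette : IsPalette F col) {M : Matrix F (suc p)} (colored : Colored F col M) where

  open Field F hiding (zero)
  open IsPalette palette
  open Determinant commutativeRing using (det; det-ones-row; det-equal-columns)
  open Independence F using (Independent; independent-cong; independent-∘; det-nonzero)
  open CofactorPolynomial F using (cofactorPolynomial; eval-cofactorPolynomial)
  open import Data.Vec.Functional.Relation.Binary.Equality.Setoid setoid using (_≋_)

  colour : Fin (suc p) → Fin (suc p)
  colour = proj₁ ∘ colored

  column≋colour : ∀ j → column F M j ≋ col (colour j)
  column≋colour = proj₂ ∘ colored

  eval≈det : eval F (cofactorPolynomial p) M ≈ det (column F M)
  eval≈det = trans (eval-cofactorPolynomial p M)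
                   (sym (det-ones-row (column F M) λ t → trans (column≋colour t zero) (firstEntry (colour t))))

  same-colour⇒same-column : ∀ {i j} → colour i ≡ colour j → column F M i ≋ column F M j
  same-colour⇒same-column {i} {j} same r =
    trans (column≋colour i r) (trans (reflexive (≡.cong (λ k → col k r) same)) (sym (column≋colour j r)))

  injective-colour⇒independent : Injective _≡_ _≡_ colour → Independent (column F M)
  injective-colour⇒independent injective = independent-cong column≋colour (independent-∘ {v = col} injective independent)

  vanishing⇒repeated-column : eval F (cofactorPolynomial p) M ≈ 0# →
                              ∃₂ λ i j → i ≢ j × column F M i ≋ column F M j
  vanishing⇒repeated-column eval≈0 with injective-or-collision colour
  ... | inj₁ injective             = contradiction (trans (sym eval≈det) eval≈0)
                                                   (det-nonzero (column F M) (injective-colour⇒independent injective))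
  ... | inj₂ (i , j , i≢j , same) = i , j , i≢j , same-colour⇒same-column same

  repeated-column⇒vanishing : (∃₂ λ i j → i ≢ j × column F M i ≋ column F M j) →
                              eval F (cofactorPolynomial p) M ≈ 0#
  repeated-column⇒vanishing (i , j , i≢j , same) = trans eval≈det (det-equal-columns _ i≢j same)

lemma2p4 : ∀ {c ℓ : Level} (F : Field c ℓ) (p : ℕ) → 1 ≤ p →
    let q = suc p in
    (col : Fin q → Vector F q) → IsPalette F col →
    Σ (Polynomial F q) λ f → HasDegree F f (q ∸ 1) ×
      (∀ (M : Matrix F q) → Colored F col M →
        (Field._≈_ F (eval F f M) (Field.0# F) ⇔
          ∃ λ (i : Fin q) → ∃ λ (j : Fin q) → ¬ (i ≡ j) ×
            (∀ (r : Fin q) → Field._≈_ F (M r i) (M r j))))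
lemma2p4 F p _ col palette = cofactorPolynomial p , cofactorPolynomial-degree p , λ M colored →
  let open ColoredMatrix F palette colored in mk⇔ vanishing⇒repeated-column repeated-column⇒vanishing
  where open CofactorPolynomial F using (cofactorPolynomial; cofactorPolynomial-degree)
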